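{- Given integers $f, g, h$ with $g\ge 1$, $2g\ge f+1$, $h\ge f$, consider two Frobenius symbols \[ L=\begin{pmatrix} a_1 & \cdots & a_{t-1} \\ b_1 & \cdots & b_{t-1} \end{pmatrix}\quad\text{and}\quad R=\begin{pmatrix} \alpha_1 & \cdots & \alpha_{\tau} \\ \beta_1 & \cdots & \beta_{\tau}\end{pmatrix}\neq \emptyset, \] such that (i) $a_y - b_y \ge f$ for all $1\le y \le t-1$, (ii) $\alpha_1 - \beta_1 \le f-2g+1$, (iii) $a_{t-1}> \alpha_1+g-1$, (iv) $b_{t-1}> \beta_1-g+1 \ge 0$. Let \[ \mu=\begin{pmatrix} \mu_{11} & \mu_{12} & \cdots & \mu_{1\delta'}\\ \mu_{21} & \mu_{22} & \cdots & \mu_{2\delta'}\end{pmatrix}:=c_{g-f+1}(L)\,d_{f-2g+1}(R), \] where the first $t-1$ columns of $\mu$ are those of $c_{g-f+1}(L)$ and the remaining columns are those of $d_{f-2g+1}(R)$. Then: (1) $\mu$ is a Frobenius symbol. (2) $\mu_{1y} - \mu_{2y} \le f-2g-2$ for all $1\le y \le t-1$, and $\mu_{1t} - \mu_{2t} \ge f-2g-1$ if $\mu_{1t}$ and $\mu_{2t}$ exist. (3) $\mathrm{rank}(\mu)\le -h+2f-2g-2$ if $L\neq \emptyset$ and $\mathrm{rank}(L)\ge h$. (4) The correspondence from $(L,R)$ to $\mu$ is reversible. (5) $|L|+|R|-|\mu|=2g-f$.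
   Context: A Frobenius symbol is a two-rowed array $\begin{pmatrix} a_1 & \cdots & a_\delta\\ b_1 & \cdots & b_\delta\end{pmatrix}$ with $a_1>\cdots>a_\delta\ge 0$, $b_1>\cdots>b_\delta\ge0$, representing a partition of $\sum_t(a_t+b_t+1)$ (via $a_t=\lambda_t-t$, $b_t=\lambda'_t-t$ for $t$ up to the Durfee square size); Frobenius symbols are identified with ordinary partitions, the empty symbol with the empty partition $\emptyset$. $|\lambda|$ is the sum of parts, $\ell(\lambda)$ the number of parts, and $\mathrm{rank}(\lambda)=\lambda_1-\ell(\lambda)$, which equals $a_1-b_1$ for the first column of the Frobenius symbol; $\mathrm{rank}(\emptyset)=0$. For a partition $\lambda$ with $\mathrm{rank}(\lambda)\le r$, the Dyson map $d_r(\lambda)$ is obtained by subtracting $1$ from each part of $\lambda$ and then adding a part of size $r-1+\ell(\lambda)$; $d_r(\lambda)$ is a partition of $|\lambda|+r-1$ with $\mathrm{rank}(d_r(\lambda))\ge r-2$, and if nonempty its Frobenius symbol has upper-left entry $b_1+r-1$. The shifted conjugate map $c_u$ sends $\begin{pmatrix} a_1 & \cdots & a_\delta\\ b_1 & \cdots & b_\delta\end{pmatrix}$ to $\begin{pmatrix} b_1-u & \cdots & b_\delta-u\\ a_1+u & \cdots & a_\delta+u\end{pmatrix}$, with $c_u(\emptyset)=\emptyset$ and $c_u^{ -1}=c_u$. -}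

module Defs where

open import Data.Bool using (Bool; true; false; if_then_else_)
open import Data.Nat as ℕ using (ℕ; zero; suc; _∸_; _≤ᵇ_)
open import Data.Integer as ℤ using (ℤ; +_; _-_; _+_; _≤_; _<_; ∣_∣)
open import Data.List using (List; []; _∷_; length; map; applyUpTo; filterᵇ; _++_; last)
open import Data.List.Relation.Unary.All using (All)
open import Data.List.Relation.Unary.Linked using (Linked)
open import Data.Maybe using (just)
open import Data.Product using (_×_; _,_; proj₁; proj₂)
open import Relation.Binary.PropositionalEquality using (_≡_; _≢_)

IsPartition : List ℕ → Set
IsPartition λs = Linked ℕ._≥_ λs × All (ℕ._<_ 0) λs

size : List ℕ → ℕ
size [] = 0
size (x ∷ xs) = x ℕ.+ size xs

rank : List ℕ → ℤ
rank [] = + 0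
rank (x ∷ xs) = + x - + length (x ∷ xs)

-- conjugate partition: λ'_j = #{ i : λ_i ≥ j },  j = 1 .. λ₁
conj : List ℕ → List ℕ
conj [] = []
conj (x ∷ xs) = applyUpTo (λ j → length (filterᵇ (λ p → suc j ≤ᵇ p) (x ∷ xs))) x

-- Frobenius symbols: lists of columns (upper entry , lower entry).
-- Entries are integers so that shifted maps can be applied before
-- checking that the result is a genuine Frobenius symbol.

Column : Set
Column = ℤ × ℤ

IsFrobenius : List Column → Set
IsFrobenius cs =
  Linked (λ p q → proj₁ q < proj₁ p × proj₂ q < proj₂ p) cs
  × All (λ p → + 0 ≤ proj₁ p × + 0 ≤ proj₂ p) cs

-- Frobenius symbol of a partition: columns t = 1 .. (Durfee size),
-- a_t = λ_t - t, b_t = λ'_t - t.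
frobAux : ℕ → List ℕ → List ℕ → List Column
frobAux i (x ∷ xs) (y ∷ ys) =
  if i ≤ᵇ x then (+ (x ∸ i) , + (y ∸ i)) ∷ frobAux (suc i) xs ys else []
frobAux i _ _ = []

frob : List ℕ → List Column
frob λs = frobAux 1 λs (conj λs)

sizeF : List Column → ℤ
sizeF [] = + 0
sizeF ((a , b) ∷ cs) = a + b + + 1 + sizeF cs

rankF : List Column → ℤ
rankF [] = + 0
rankF ((a , b) ∷ _) = a - b

-- Dyson map d_r: subtract 1 from each part, add a part r - 1 + ℓ(λ)
-- (parts equal to 0 are discarded).  Meaningful when rank(λ) ≤ r,
-- in which case r - 1 + ℓ(λ) ≥ λ₁ - 1 ≥ 0 is the largest part.

dropZeros : List ℕ → List ℕ
dropZeros [] = []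
dropZeros (zero ∷ xs) = dropZeros xs
dropZeros (suc x ∷ xs) = suc x ∷ dropZeros xs

dyson : ℤ → List ℕ → List ℕ
dyson r λs = dropZeros (∣ r - + 1 + + length λs ∣ ∷ map (_∸ 1) λs)

cCol : ℤ → Column → Column
cCol u (a , b) = (b - u , a + u)

c : ℤ → List Column → List Column
c u = map (cCol u)

mu : ℤ → ℤ → List ℕ → List ℕ → List Column
mu f g L R = c (g - f + + 1) (frob L) ++ frob (dyson (f - (g + g) + + 1) R)

-- Hypotheses (i)–(iv) on the pair (L , R), R ≠ ∅.
-- Column (a_y , b_y) of L, y = 1 .. t-1; first column (α₁ , β₁) of R.
record Hyp (f g : ℤ) (L R : List ℕ) : Set where
  field
    L-partition : IsPartition L
    R-partition : IsPartition R
    R-nonempty  : R ≢ []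
    hyp-i   : All (λ p → f ≤ proj₁ p - proj₂ p) (frob L)
    hyp-ii  : ∀ α₁ β₁ rest → frob R ≡ (α₁ , β₁) ∷ rest →
              α₁ - β₁ ≤ f - (g + g) + + 1
    hyp-iii-iv : ∀ α₁ β₁ rest → frob R ≡ (α₁ , β₁) ∷ rest →
                 ∀ a b → last (frob L) ≡ just (a , b) →
                 (α₁ + g - + 1 < a) × (β₁ - g + + 1 < b)
    hyp-iv-nonneg : ∀ α₁ β₁ rest → frob R ≡ (α₁ , β₁) ∷ rest →
                    + 0 ≤ β₁ - g + + 1

module Submission where

open import Defs
open import Data.Integer using (ℤ; +_; -_; _+_; _-_; _≤_)
open import Data.Nat using (ℕ)
open import Data.List using (List; []; _∷_; length; take; drop)
open import Data.List.Relation.Unary.All using (All)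
open import Data.Product using (_×_; _,_; proj₁; proj₂)
open import Relation.Binary.PropositionalEquality using (_≡_; _≢_)

open import Algebra.Bundles using (AbelianGroup)
open import Data.Bool using (true; false; T)
open import Data.Bool.Properties using (T-≡)
open import Data.Empty using (⊥; ⊥-elim)
open import Data.Integer as ℤ using (_<_; ∣_∣)
import Data.Integer.Properties as ℤP
open import Data.Integer.Tactic.RingSolver as ℤSolver using ()
open import Data.List using (map; applyUpTo; filterᵇ; _++_; head; last)
open import Data.List.Properties
  using (∷-injective; ∷-injectiveʳ; map-injective; last-map; map-applyUpTo; length-applyUpTo; length-map)
open import Data.List.Relation.Unary.All as All using ([]; _∷_)
import Data.List.Relation.Unary.All.Properties as AllP
open import Data.List.Relation.Unary.Linked as Linked using (Linked; []; _∷_; _∷′_)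
import Data.List.Relation.Unary.Linked.Properties as LinkedP
open import Data.Maybe using (just; nothing)
open import Data.Maybe.Relation.Binary.Connected
  using (Connected; just-nothing; nothing-just; nothing) renaming (just to connected)
open import Data.Nat as ℕ using (zero; suc; _∸_; _≤ᵇ_; _<ᵇ_; z≤n; s≤s)
import Data.Nat.Properties as ℕP
open import Data.Nat.Tactic.RingSolver as ℕSolver using ()
open import Data.Unit using (tt)
open import Function.Bundles using (Equivalence)
open import Function.Definitions using (Injective)
open import Relation.Nullary using (contradiction)
open import Relation.Binary.PropositionalEquality using (refl; sym; trans; cong; cong₂; subst; module ≡-Reasoning)

open import Algebra.Properties.Group (AbelianGroup.group ℤP.+-0-abelianGroup) using (∙-cancelˡ; ∙-cancelʳ)

-- Proof of Lemma 3.3.  Everything rests on the hook lemma: the first column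
-- of the Frobenius symbol of a partition x ∷ xs is (x - 1 , ℓ(xs)), and the
-- remaining columns are the Frobenius symbol of dropColumn xs, the partition
-- left after deleting the first row and the first column.
--   1. Column removal on partitions, and the hook lemma (via the conjugate).
--   2. Induction along the hook decomposition: frob λ is a genuine Frobenius
--      symbol, |frob λ| = |λ|, rank λ = a₁ - b₁, and frob is injective.
--   3. The Dyson map d_r(λ) is (r - 1 + ℓ(λ) + 1) ∷ λ with its first column
--      removed; hence it is a partition of |λ| + r - 1, its first column is
--      (b₁ + r - 1 , ≤ ℓ(λ)), and it is injective on partitions of rank ≤ r.
--   4. The shifted conjugate c_u preserves sizes and the column order and is
--      injective; a few list facts about concatenation.
--   5. Linear inequalities linking the hypotheses (i)–(iv) to the entries of μ.
-- The theorem then assembles (1)–(5): the junction between c_u(L) and d_r(R)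
-- uses (i) and (iv); reversibility splits μ at the first column of rank
-- ≥ f - 2g - 1 and inverts c_u, frob and d_r.

Decreasing : List ℕ → Set
Decreasing = Linked ℕ._≥_

hd : List ℕ → ℕ
hd [] = 0
hd (x ∷ _) = x

dropColumn : List ℕ → List ℕ
dropColumn ps = dropZeros (map (_∸ 1) ps)

bounded-by-head : ∀ {x xs} → Decreasing (x ∷ xs) → All (ℕ._≤ x) xs
bounded-by-head {x} dec with LinkedP.Linked⇒All (λ p q → ℕP.≤-trans q p) (ℕP.≤-refl {x}) dec
... | _ ∷ bounds = bounds

head-bounded : ∀ {b} ws → All (ℕ._≤ b) ws → hd ws ℕ.≤ b
head-bounded [] _ = z≤n
head-bounded (_ ∷ _) (p ∷ _) = p

dropZeros-All : ∀ {P : ℕ → Set} ws → All P ws → All P (dropZeros ws)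
dropZeros-All [] [] = []
dropZeros-All (zero ∷ ws) (_ ∷ ps) = dropZeros-All ws ps
dropZeros-All (suc w ∷ ws) (p ∷ ps) = p ∷ dropZeros-All ws ps

dropZeros-positive : ∀ ws → All (ℕ._<_ 0) (dropZeros ws)
dropZeros-positive [] = []
dropZeros-positive (zero ∷ ws) = dropZeros-positive ws
dropZeros-positive (suc w ∷ ws) = s≤s z≤n ∷ dropZeros-positive ws

dropZeros-zeros : ∀ ws → Decreasing (0 ∷ ws) → dropZeros ws ≡ []
dropZeros-zeros [] _ = refl
dropZeros-zeros (zero ∷ ws) (_ ∷ dec) = dropZeros-zeros ws dec
dropZeros-zeros (suc w ∷ ws) (() ∷ _)

dropZeros-decreasing : ∀ ws → Decreasing ws → Decreasing (dropZeros ws)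
dropZeros-decreasing [] _ = []
dropZeros-decreasing (zero ∷ ws) dec = dropZeros-decreasing ws (Linked.tail dec)
dropZeros-decreasing (suc w ∷ ws) dec =
  link (dropZeros-All ws (bounded-by-head dec)) ∷′ dropZeros-decreasing ws (Linked.tail dec)
  where
  link : ∀ {x ys} → All (ℕ._≤ x) ys → Connected ℕ._≥_ (just x) (head ys)
  link [] = just-nothing
  link (p ∷ _) = connected p

dropZeros-length : ∀ ws → length (dropZeros ws) ℕ.≤ length ws
dropZeros-length [] = z≤n
dropZeros-length (zero ∷ ws) = ℕP.m≤n⇒m≤1+n (dropZeros-length ws)
dropZeros-length (suc w ∷ ws) = s≤s (dropZeros-length ws)

dropZeros-size : ∀ ws → size (dropZeros ws) ≡ size ws
dropZeros-size [] = refl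
dropZeros-size (zero ∷ ws) = dropZeros-size ws
dropZeros-size (suc w ∷ ws) = cong (suc w ℕ.+_) (dropZeros-size ws)

pred-decreasing : ∀ ws → Decreasing ws → Decreasing (map (_∸ 1) ws)
pred-decreasing ws dec = LinkedP.map⁺ (Linked.map (ℕP.∸-monoˡ-≤ 1) dec)

dropColumn-partition : ∀ ps → Decreasing ps → IsPartition (dropColumn ps)
dropColumn-partition ps dec =
  dropZeros-decreasing (map (_∸ 1) ps) (pred-decreasing ps dec) , dropZeros-positive (map (_∸ 1) ps)

dropColumn-head : ∀ {x xs} → Decreasing (x ∷ xs) → hd (dropColumn xs) ℕ.≤ x ∸ 1
dropColumn-head {x} {xs} dec =
  head-bounded (dropColumn xs) (dropZeros-All (map (_∸ 1) xs) (pred-bounds xs (bounded-by-head dec)))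
  where
  pred-bounds : ∀ ws → All (ℕ._≤ x) ws → All (ℕ._≤ x ∸ 1) (map (_∸ 1) ws)
  pred-bounds [] [] = []
  pred-bounds (w ∷ ws) (p ∷ ps) = ℕP.∸-monoˡ-≤ 1 p ∷ pred-bounds ws ps

dropColumn-length : ∀ ps → length (dropColumn ps) ℕ.≤ length ps
dropColumn-length ps = ℕP.≤-trans (dropZeros-length (map (_∸ 1) ps)) (ℕP.≤-reflexive (length-map (_∸ 1) ps))

-- The first column of a partition has ℓ(λ) cells.
dropColumn-size : ∀ ps → All (ℕ._<_ 0) ps → size (dropColumn ps) ℕ.+ length ps ≡ size ps
dropColumn-size ps pos = trans (cong (ℕ._+ length ps) (dropZeros-size (map (_∸ 1) ps))) (pred-size ps pos)
  where
  pred-size : ∀ ws → All (ℕ._<_ 0) ws → size (map (_∸ 1) ws) ℕ.+ length ws ≡ size ws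
  pred-size [] [] = refl
  pred-size (suc w ∷ ws) (_ ∷ pos) = begin
    w ℕ.+ size (map (_∸ 1) ws) ℕ.+ suc (length ws)   ≡⟨ ℕP.+-suc _ (length ws) ⟩
    suc (w ℕ.+ size (map (_∸ 1) ws) ℕ.+ length ws)   ≡⟨ cong suc (ℕP.+-assoc w _ _) ⟩
    suc (w ℕ.+ (size (map (_∸ 1) ws) ℕ.+ length ws)) ≡⟨ cong (λ s → suc (w ℕ.+ s)) (pred-size ws pos) ⟩
    suc (w ℕ.+ size ws)                              ∎
    where open ≡-Reasoning

-- The hook lemma.  frob reads the Frobenius symbol off a partition and its
-- conjugate; removing the first column of a partition removes the first
-- entry of the conjugate and lowers the others by one.

-- Number of parts exceeding j, i.e. the (j+1)-st part of the conjugate.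
count : ℕ → List ℕ → ℕ
count j ps = length (filterᵇ (λ q → suc j ≤ᵇ q) ps)

conj-count : ∀ ps → conj ps ≡ applyUpTo (λ j → count j ps) (hd ps)
conj-count [] = refl
conj-count (p ∷ ps) = refl

count-pred : ∀ j ps → count j (map (_∸ 1) ps) ≡ count (suc j) ps
count-pred j [] = refl
count-pred j (zero ∷ ps) = count-pred j ps
count-pred j (suc p ∷ ps) with j <ᵇ p
... | true = cong suc (count-pred j ps)
... | false = count-pred j ps

count-dropZeros : ∀ j ws → count j (dropZeros ws) ≡ count j ws
count-dropZeros j [] = refl
count-dropZeros j (zero ∷ ws) = count-dropZeros j ws
count-dropZeros j (suc w ∷ ws) with j <ᵇ suc w
... | true = cong suc (count-dropZeros j ws)
... | false = count-dropZeros j ws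

count-zero : ∀ ps → All (ℕ._<_ 0) ps → count 0 ps ≡ length ps
count-zero [] [] = refl
count-zero (suc p ∷ ps) (_ ∷ pos) = cong suc (count-zero ps pos)

count-cons : ∀ j x xs → suc j ℕ.≤ x → count j (x ∷ xs) ≡ suc (count j xs)
count-cons j x xs j<x rewrite Equivalence.to T-≡ (ℕP.≤⇒≤ᵇ j<x) = refl

count-dropColumn : ∀ j x xs → suc j ℕ.< x → count (suc j) (x ∷ xs) ∸ 1 ≡ count j (dropColumn xs)
count-dropColumn j x xs j+1<x = begin
  count (suc j) (x ∷ xs) ∸ 1           ≡⟨ cong (_∸ 1) (count-cons (suc j) x xs j+1<x) ⟩
  count (suc j) xs                     ≡⟨ sym (count-pred j xs) ⟩
  count j (map (_∸ 1) xs)              ≡⟨ sym (count-dropZeros j (map (_∸ 1) xs)) ⟩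
  count j (dropColumn xs)              ∎
  where open ≡-Reasoning

≤ᵇ-false : ∀ m n → n ℕ.< m → (m ≤ᵇ n) ≡ false
≤ᵇ-false m n n<m with m ≤ᵇ n in eq
... | true = contradiction (ℕP.≤ᵇ⇒≤ m n (subst T (sym eq) tt)) (ℕP.<⇒≱ n<m)
... | false = refl

frobAux-[] : ∀ i xs → frobAux i xs [] ≡ []
frobAux-[] i [] = refl
frobAux-[] i (x ∷ xs) = refl

frobAux-shift : ∀ k xs ys → frobAux (suc (suc k)) xs ys ≡ frobAux (suc k) (map (_∸ 1) xs) (map (_∸ 1) ys)
frobAux-shift k [] ys = refl
frobAux-shift k (x ∷ xs) [] = refl
frobAux-shift k (zero ∷ xs) (y ∷ ys) = refl
frobAux-shift k (suc x ∷ xs) (zero ∷ ys) with k <ᵇ x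
... | true = cong (_ ∷_) (frobAux-shift (suc k) xs ys)
... | false = refl
frobAux-shift k (suc x ∷ xs) (suc y ∷ ys) with k <ᵇ x
... | true = cong (_ ∷_) (frobAux-shift (suc k) xs ys)
... | false = refl

frobAux-dropZeros : ∀ k ws zs → Decreasing ws → frobAux (suc k) ws zs ≡ frobAux (suc k) (dropZeros ws) zs
frobAux-dropZeros k [] zs _ = refl
frobAux-dropZeros k (zero ∷ ws) [] _ = sym (frobAux-[] _ (dropZeros ws))
frobAux-dropZeros k (zero ∷ ws) (z ∷ zs) dec rewrite dropZeros-zeros ws dec = refl
frobAux-dropZeros k (suc w ∷ ws) [] _ = refl
frobAux-dropZeros k (suc w ∷ ws) (z ∷ zs) dec with k <ᵇ suc w
... | true = cong (_ ∷_) (frobAux-dropZeros (suc k) ws zs (Linked.tail dec))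
... | false = refl

frobAux-++ : ∀ k xs zs rest → Decreasing xs → hd xs ℕ.≤ length zs ℕ.+ k →
             frobAux (suc k) xs (zs ++ rest) ≡ frobAux (suc k) xs zs
frobAux-++ k [] zs rest _ _ = refl
frobAux-++ k (x ∷ xs) [] [] _ _ = refl
frobAux-++ k (x ∷ xs) [] (r ∷ rest) _ x≤k rewrite ≤ᵇ-false (suc k) x (s≤s x≤k) = refl
frobAux-++ k (x ∷ xs) (z ∷ zs) rest dec x≤ with k <ᵇ x
... | true = cong (_ ∷_) (frobAux-++ (suc k) xs zs rest (Linked.tail dec)
               (ℕP.≤-trans (head-bounded xs (bounded-by-head dec))
                 (ℕP.≤-trans x≤ (ℕP.≤-reflexive (sym (ℕP.+-suc (length zs) k))))))
... | false = refl

applyUpTo-cong : ∀ {A : Set} (f g : ℕ → A) n → (∀ j → j ℕ.< n → f j ≡ g j) → applyUpTo f n ≡ applyUpTo g n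
applyUpTo-cong f g zero _ = refl
applyUpTo-cong f g (suc n) f≗g =
  cong₂ _∷_ (f≗g 0 (s≤s z≤n)) (applyUpTo-cong (λ j → f (suc j)) (λ j → g (suc j)) n (λ j p → f≗g (suc j) (s≤s p)))

applyUpTo-+ : ∀ {A : Set} (f : ℕ → A) m n → applyUpTo f (m ℕ.+ n) ≡ applyUpTo f m ++ applyUpTo (λ j → f (m ℕ.+ j)) n
applyUpTo-+ f zero n = refl
applyUpTo-+ f (suc m) n = cong (f 0 ∷_) (applyUpTo-+ (λ j → f (suc j)) m n)

hook : ∀ x xs → IsPartition (x ∷ xs) → frob (x ∷ xs) ≡ (+ (x ∸ 1) , + length xs) ∷ frob (dropColumn xs)
hook (suc x) xs (dec , _ ∷ pos) = cong₂ (λ l cs → (+ x , + l) ∷ cs) (count-zero xs pos) rest-columns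
  where
  P : List ℕ
  P = dropColumn xs
  -- the conjugate of x ∷ xs without its first entry
  cols : List ℕ
  cols = applyUpTo (λ j → count (suc j) (suc x ∷ xs)) x
  P-dec : Decreasing P
  P-dec = proj₁ (dropColumn-partition xs (Linked.tail dec))
  hd-P : hd P ℕ.≤ x
  hd-P = dropColumn-head dec
  beyond : List ℕ
  beyond = applyUpTo (λ j → count (hd P ℕ.+ j) P) (x ∸ hd P)
  -- removing the first column of those conjugate entries gives conj P, padded
  cols-conj : map (_∸ 1) cols ≡ conj P ++ beyond
  cols-conj = begin
    map (_∸ 1) cols                                   ≡⟨ map-applyUpTo _ (_∸ 1) x ⟩
    applyUpTo (λ j → count (suc j) (suc x ∷ xs) ∸ 1) x ≡⟨ applyUpTo-cong _ _ x (λ j j<x → count-dropColumn j (suc x) xs (s≤s j<x)) ⟩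
    applyUpTo (λ j → count j P) x                     ≡⟨ cong (applyUpTo (λ j → count j P)) (sym (ℕP.m+[n∸m]≡n hd-P)) ⟩
    applyUpTo (λ j → count j P) (hd P ℕ.+ (x ∸ hd P)) ≡⟨ applyUpTo-+ _ (hd P) (x ∸ hd P) ⟩
    applyUpTo (λ j → count j P) (hd P) ++ beyond      ≡⟨ cong (_++ beyond) (sym (conj-count P)) ⟩
    conj P ++ beyond                                  ∎
    where open ≡-Reasoning
  conj-long : hd P ℕ.≤ length (conj P) ℕ.+ 0
  conj-long = ℕP.≤-reflexive (sym (begin
    length (conj P) ℕ.+ 0  ≡⟨ ℕP.+-identityʳ _ ⟩
    length (conj P)        ≡⟨ cong length (conj-count P) ⟩
    length (applyUpTo (λ j → count j P) (hd P)) ≡⟨ length-applyUpTo _ (hd P) ⟩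
    hd P                   ∎))
    where open ≡-Reasoning
  rest-columns : frobAux 2 xs cols ≡ frob P
  rest-columns = begin
    frobAux 2 xs cols                            ≡⟨ frobAux-shift 0 xs cols ⟩
    frobAux 1 (map (_∸ 1) xs) (map (_∸ 1) cols)  ≡⟨ frobAux-dropZeros 0 _ _ (pred-decreasing xs (Linked.tail dec)) ⟩
    frobAux 1 P (map (_∸ 1) cols)                ≡⟨ cong (frobAux 1 P) cols-conj ⟩
    frobAux 1 P (conj P ++ beyond)               ≡⟨ frobAux-++ 0 P (conj P) beyond P-dec conj-long ⟩
    frobAux 1 P (conj P)                         ∎
    where open ≡-Reasoning

partition-induction : (P : List ℕ → Set) → P [] →
  (∀ x xs → IsPartition (x ∷ xs) → P (dropColumn xs) → P (x ∷ xs)) →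
  ∀ ps → IsPartition ps → P ps
partition-induction P base step ps = go (length ps) ps ℕP.≤-refl
  where
  go : ∀ n ps → length ps ℕ.≤ n → IsPartition ps → P ps
  go n [] _ _ = base
  go (suc n) (x ∷ xs) (s≤s ℓ≤n) pt = step x xs pt
    (go n (dropColumn xs) (ℕP.≤-trans (dropColumn-length xs) ℓ≤n) (dropColumn-partition xs (Linked.tail (proj₁ pt))))

dropColumn-injective : ∀ xs ys → IsPartition xs → IsPartition ys → length xs ≡ length ys →
                       dropColumn xs ≡ dropColumn ys → xs ≡ ys
dropColumn-injective [] [] _ _ _ _ = refl
dropColumn-injective (zero ∷ xs) _ (_ , () ∷ _) _ _ _
dropColumn-injective _ (zero ∷ ys) _ (_ , () ∷ _) _ _
dropColumn-injective (suc zero ∷ xs) (suc zero ∷ ys) (dx , _ ∷ px) (dy , _ ∷ py) ℓ≡ eq =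
  cong (1 ∷_) (dropColumn-injective xs ys (Linked.tail dx , px) (Linked.tail dy , py) (ℕP.suc-injective ℓ≡) eq)
dropColumn-injective (suc zero ∷ xs) (suc (suc y) ∷ ys) (dx , _) _ _ eq
  with trans (sym (dropZeros-zeros (map (_∸ 1) xs) (pred-decreasing (1 ∷ xs) dx))) eq
... | ()
dropColumn-injective (suc (suc x) ∷ xs) (suc zero ∷ ys) _ (dy , _) _ eq
  with trans eq (dropZeros-zeros (map (_∸ 1) ys) (pred-decreasing (1 ∷ ys) dy))
... | ()
dropColumn-injective (suc (suc x) ∷ xs) (suc (suc y) ∷ ys) (dx , _ ∷ px) (dy , _ ∷ py) ℓ≡ eq
  with ∷-injective eq
... | refl , eq′ = cong (suc (suc x) ∷_)
        (dropColumn-injective xs ys (Linked.tail dx , px) (Linked.tail dy , py) (ℕP.suc-injective ℓ≡) eq′)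

_≻_ : Column → Column → Set
p ≻ q = proj₁ q < proj₁ p × proj₂ q < proj₂ p

hook-≻ : ∀ x xs → IsPartition (x ∷ xs) →
         Connected _≻_ (just (+ (x ∸ 1) , + length xs)) (head (frob (dropColumn xs)))
hook-≻ x xs pt = dominates (dropColumn xs) refl
  where
  dominates : ∀ P → P ≡ dropColumn xs → Connected _≻_ (just (+ (x ∸ 1) , + length xs)) (head (frob P))
  dominates [] _ = just-nothing
  dominates (p ∷ ps) eq with subst IsPartition (sym eq) (dropColumn-partition xs (Linked.tail (proj₁ pt)))
  ... | P-part@(_ , s≤s _ ∷ _) =
    subst (λ cs → Connected _≻_ (just (+ (x ∸ 1) , + length xs)) (head cs)) (sym (hook p ps P-part))
      (connected ( ℤ.+<+ (subst (λ Q → hd Q ℕ.≤ x ∸ 1) (sym eq) (dropColumn-head (proj₁ pt)))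
                 , ℤ.+<+ (subst (λ Q → length Q ℕ.≤ length xs) (sym eq) (dropColumn-length xs))))

frob-isFrobenius : ∀ ps → IsPartition ps → IsFrobenius (frob ps)
frob-isFrobenius = partition-induction (λ ps → IsFrobenius (frob ps)) ([] , []) step
  where
  step : ∀ x xs → IsPartition (x ∷ xs) → IsFrobenius (frob (dropColumn xs)) → IsFrobenius (frob (x ∷ xs))
  step x xs pt (dec , nonneg) rewrite hook x xs pt =
    hook-≻ x xs pt ∷′ dec , (ℤ.+≤+ z≤n , ℤ.+≤+ z≤n) ∷ nonneg

frob-size : ∀ ps → IsPartition ps → sizeF (frob ps) ≡ + size ps
frob-size = partition-induction (λ ps → sizeF (frob ps) ≡ + size ps) refl step
  where
  step : ∀ x xs → IsPartition (x ∷ xs) → sizeF (frob (dropColumn xs)) ≡ + size (dropColumn xs) →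
         sizeF (frob (x ∷ xs)) ≡ + size (x ∷ xs)
  step (suc x) xs pt@(_ , _ ∷ pos) ih = begin
    sizeF (frob (suc x ∷ xs))                                  ≡⟨ cong sizeF (hook (suc x) xs pt) ⟩
    + x ℤ.+ + length xs ℤ.+ + 1 ℤ.+ sizeF (frob (dropColumn xs)) ≡⟨ cong (λ s → + x ℤ.+ + length xs ℤ.+ + 1 ℤ.+ s) ih ⟩
    + (x ℕ.+ length xs ℕ.+ 1 ℕ.+ size (dropColumn xs))           ≡⟨ cong +_ (rearrange x (length xs) (size (dropColumn xs))) ⟩
    + (suc x ℕ.+ (size (dropColumn xs) ℕ.+ length xs))           ≡⟨ cong (λ s → + (suc x ℕ.+ s)) (dropColumn-size xs pos) ⟩
    + size (suc x ∷ xs)                                        ∎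
    where
    open ≡-Reasoning
    rearrange : ∀ a b c → a ℕ.+ b ℕ.+ 1 ℕ.+ c ≡ suc a ℕ.+ (c ℕ.+ b)
    rearrange = ℕSolver.solve-∀

frob-injective : ∀ xs → IsPartition xs → ∀ ys → IsPartition ys → frob xs ≡ frob ys → xs ≡ ys
frob-injective = partition-induction Determined base step
  where
  Determined : List ℕ → Set
  Determined xs = ∀ ys → IsPartition ys → frob xs ≡ frob ys → xs ≡ ys
  base : Determined []
  base [] _ _ = refl
  base (y ∷ ys) py eq with trans eq (hook y ys py)
  ... | ()
  step : ∀ x xs → IsPartition (x ∷ xs) → Determined (dropColumn xs) → Determined (x ∷ xs)
  step x xs px ih [] _ eq with trans (sym eq) (hook x xs px)
  ... | ()
  step (suc x) xs px ih (suc y ∷ ys) py eq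
    with ∷-injective (trans (sym (hook (suc x) xs px)) (trans eq (hook (suc y) ys py)))
  ... | first , rest with ℤP.+-injective (cong proj₁ first)
  ... | refl = cong (suc x ∷_) (dropColumn-injective xs ys
                 (Linked.tail (proj₁ px) , All.tail (proj₂ px)) (Linked.tail (proj₁ py) , All.tail (proj₂ py))
                 (ℤP.+-injective (cong proj₂ first))
                 (ih (dropColumn ys) (dropColumn-partition ys (Linked.tail (proj₁ py))) rest))
  step zero xs (_ , () ∷ _)
  step (suc x) xs _ _ (zero ∷ ys) (_ , () ∷ _) _

rank-frob : ∀ ps → IsPartition ps → rankF (frob ps) ≡ rank ps
rank-frob [] _ = refl
rank-frob (zero ∷ xs) (_ , () ∷ _)
rank-frob (suc x ∷ xs) pt = trans (cong rankF (hook (suc x) xs pt)) (shift (+ x) (+ length xs))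
  where
  shift : ∀ a b → a - b ≡ (+ 1 + a) - (+ 1 + b)
  shift = ℤSolver.solve-∀

first-column-after-removal : ∀ N ps → IsPartition (suc N ∷ ps) → ∀ p q rest →
  frob (dropColumn (suc N ∷ ps)) ≡ (p , q) ∷ rest → + 1 + p ≡ + N × q ≤ + length ps
first-column-after-removal zero ps (dec , _) p q rest eq
  with trans (sym (cong frob (dropZeros-zeros (map (_∸ 1) ps) (pred-decreasing (1 ∷ ps) dec)))) eq
... | ()
first-column-after-removal (suc n) ps pt p q rest eq
  with ∷-injective (trans (sym (hook (suc n) (dropColumn ps) (dropColumn-partition (suc (suc n) ∷ ps) (proj₁ pt)))) eq)
... | column , _ = cong (λ t → + 1 + t) (sym (cong proj₁ column)) ,
                   subst (_≤ + length ps) (cong proj₂ column) (ℤ.+≤+ (dropColumn-length ps))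

hd-dropZeros : ∀ N ws → Decreasing (N ∷ ws) → hd (dropZeros (N ∷ ws)) ≡ N
hd-dropZeros zero ws dec rewrite dropZeros-zeros ws dec = refl
hd-dropZeros (suc n) ws _ = refl

newPart : ℤ → List ℕ → ℤ
newPart r ps = r - + 1 + + length ps

x-1≤newPart : ∀ r x xs → IsPartition (x ∷ xs) → rank (x ∷ xs) ≤ r → + (x ∸ 1) ≤ newPart r (x ∷ xs)
x-1≤newPart r zero xs (_ , () ∷ _) _
x-1≤newPart r (suc x) xs _ rank≤r =
  ℤP.0≤i-j⇒j≤i (subst (+ 0 ≤_) (shift (+ x) (+ length xs) r) (ℤP.i≤j⇒0≤j-i rank≤r))
  where
  shift : ∀ a b r → r - (+ 1 + a - (+ 1 + b)) ≡ r - + 1 + (+ 1 + b) - a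
  shift = ℤSolver.solve-∀

prepend-partition : ∀ N x xs → IsPartition (x ∷ xs) → x ∸ 1 ℕ.≤ N → IsPartition (suc N ∷ x ∷ xs)
prepend-partition N zero xs (_ , () ∷ _) _
prepend-partition N (suc x) xs (dec , pos) x≤N = s≤s x≤N ∷ dec , s≤s z≤n ∷ pos

-- The Dyson map d_r on a nonempty partition λ = x ∷ xs of rank ≤ r.  Writing
-- N = r - 1 + ℓ(λ) ≥ x - 1 for the new part, d_r(λ) is the partition
-- (N + 1) ∷ λ with its first column removed.
module Dyson (r : ℤ) (x : ℕ) (xs : List ℕ) (λ-part : IsPartition (x ∷ xs)) (rank≤r : rank (x ∷ xs) ≤ r) where

  N : ℕ
  N = ∣ newPart r (x ∷ xs) ∣

  N-eq : + N ≡ newPart r (x ∷ xs)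
  N-eq = ℤP.0≤i⇒+∣i∣≡i (ℤP.≤-trans (ℤ.+≤+ z≤n) (x-1≤newPart r x xs λ-part rank≤r))

  extended-partition : IsPartition (suc N ∷ x ∷ xs)
  extended-partition = prepend-partition N x xs λ-part
    (ℤP.drop‿+≤+ (subst (+ (x ∸ 1) ≤_) (sym N-eq) (x-1≤newPart r x xs λ-part rank≤r)))

  dyson-partition : IsPartition (dyson r (x ∷ xs))
  dyson-partition = dropColumn-partition (suc N ∷ x ∷ xs) (proj₁ extended-partition)

  dyson-size : + size (dyson r (x ∷ xs)) ≡ + size (x ∷ xs) + r - + 1
  dyson-size = begin
    + size D                                     ≡⟨ cancel-length (+ size D) (+ length (x ∷ xs)) ⟩
    + size D + (+ 1 + + length (x ∷ xs)) - (+ 1 + + length (x ∷ xs)) ≡⟨ cong (_- (+ 1 + + length (x ∷ xs))) cells ⟩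
    + 1 + + N + + size (x ∷ xs) - (+ 1 + + length (x ∷ xs)) ≡⟨ cong (λ n → + 1 + n + + size (x ∷ xs) - (+ 1 + + length (x ∷ xs))) N-eq ⟩
    + 1 + newPart r (x ∷ xs) + + size (x ∷ xs) - (+ 1 + + length (x ∷ xs)) ≡⟨ collect (+ size (x ∷ xs)) (+ length (x ∷ xs)) r ⟩
    + size (x ∷ xs) + r - + 1                    ∎
    where
    open ≡-Reasoning
    D : List ℕ
    D = dyson r (x ∷ xs)
    cells : + size D + (+ 1 + + length (x ∷ xs)) ≡ + 1 + + N + + size (x ∷ xs)
    cells = cong +_ (dropColumn-size (suc N ∷ x ∷ xs) (proj₂ extended-partition))
    cancel-length : ∀ d l → d ≡ d + (+ 1 + l) - (+ 1 + l)
    cancel-length = ℤSolver.solve-∀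
    collect : ∀ s l r → + 1 + (r - + 1 + l) + s - (+ 1 + l) ≡ s + r - + 1
    collect = ℤSolver.solve-∀

  dyson-head : ∀ p q rest → frob (dyson r (x ∷ xs)) ≡ (p , q) ∷ rest →
               p ≡ + length xs + r - + 1 × q ≤ + length (x ∷ xs)
  dyson-head p q rest eq with first-column-after-removal N (x ∷ xs) extended-partition p q rest eq
  ... | 1+p≡N , q≤ℓ = (begin
    p                                   ≡⟨ unshift p ⟩
    - + 1 + (+ 1 + p)                   ≡⟨ cong (λ t → - + 1 + t) (trans 1+p≡N N-eq) ⟩
    - + 1 + (r - + 1 + (+ 1 + + length xs)) ≡⟨ regroup (+ length xs) r ⟩
    + length xs + r - + 1               ∎) , q≤ℓ
    where
    open ≡-Reasoning
    unshift : ∀ p → p ≡ - + 1 + (+ 1 + p)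
    unshift = ℤSolver.solve-∀
    regroup : ∀ b r → - + 1 + (r - + 1 + (+ 1 + b)) ≡ b + r - + 1
    regroup = ℤSolver.solve-∀

  dyson-largest-part : hd (dyson r (x ∷ xs)) ≡ N
  dyson-largest-part = hd-dropZeros N _ (pred-decreasing (suc N ∷ x ∷ xs) (proj₁ extended-partition))

-- d_r is injective on nonempty partitions of rank ≤ r: the largest part of
-- d_r(λ) is N = r - 1 + ℓ(λ), which recovers ℓ(λ), and a partition is
-- determined by its length and its first-column removal.
dyson-injective : ∀ r x xs x′ xs′ (pt : IsPartition (x ∷ xs)) (pt′ : IsPartition (x′ ∷ xs′)) →
                  rank (x ∷ xs) ≤ r → rank (x′ ∷ xs′) ≤ r →
                  dyson r (x ∷ xs) ≡ dyson r (x′ ∷ xs′) → x ∷ xs ≡ x′ ∷ xs′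
dyson-injective r x xs x′ xs′ pt pt′ rk rk′ eq =
  ∷-injectiveʳ (dropColumn-injective (suc D.N ∷ x ∷ xs) (suc D′.N ∷ x′ ∷ xs′)
    D.extended-partition D′.extended-partition (cong suc same-length) eq)
  where
  module D = Dyson r x xs pt rk
  module D′ = Dyson r x′ xs′ pt′ rk′
  same-N : D.N ≡ D′.N
  same-N = trans (sym D.dyson-largest-part) (trans (cong hd eq) D′.dyson-largest-part)
  same-length : length (x ∷ xs) ≡ length (x′ ∷ xs′)
  same-length = ℤP.+-injective (∙-cancelˡ (r - + 1) _ _ (trans (sym D.N-eq) (trans (cong +_ same-N) D′.N-eq)))

c-size : ∀ u cs → sizeF (c u cs) ≡ sizeF cs
c-size u [] = refl
c-size u ((a , b) ∷ cs) = cong₂ _+_ (column u a b) (c-size u cs)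
  where
  column : ∀ u a b → (b - u) + (a + u) + + 1 ≡ a + b + + 1
  column = ℤSolver.solve-∀

c-injective : ∀ u → Injective _≡_ _≡_ (c u)
c-injective u = map-injective column-injective
  where
  column-injective : Injective _≡_ _≡_ (cCol u)
  column-injective {a , b} {a′ , b′} eq =
    cong₂ _,_ (∙-cancelʳ u a a′ (cong proj₂ eq)) (∙-cancelʳ (- u) b b′ (cong proj₁ eq))

-- c_u swaps the rows, so it preserves the strict decrease of both rows.
c-descending : ∀ u cs → Linked _≻_ cs → Linked _≻_ (c u cs)
c-descending u cs desc =
  LinkedP.map⁺ (Linked.map (λ (upper , lower) → ℤP.+-monoˡ-< (- u) lower , ℤP.+-monoˡ-< u upper) desc)

sizeF-++ : ∀ A B → sizeF (A ++ B) ≡ sizeF A + sizeF B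
sizeF-++ [] B = sym (ℤP.+-identityˡ (sizeF B))
sizeF-++ ((a , b) ∷ A) B =
  trans (cong (λ s → a + b + + 1 + s) (sizeF-++ A B)) (sym (ℤP.+-assoc (a + b + + 1) (sizeF A) (sizeF B)))

take-map-++ : ∀ {A : Set} (φ : A → A) (xs ys : List A) → take (length xs) (map φ xs ++ ys) ≡ map φ xs
take-map-++ φ [] ys = refl
take-map-++ φ (x ∷ xs) ys = cong (φ x ∷_) (take-map-++ φ xs ys)

drop-map-++ : ∀ {A : Set} (φ : A → A) (xs ys : List A) → drop (length xs) (map φ xs ++ ys) ≡ ys
drop-map-++ φ [] ys = refl
drop-map-++ φ (x ∷ xs) ys = drop-map-++ φ xs ys

last-All : ∀ {A : Set} {P : A → Set} {z} xs → All P xs → last xs ≡ just z → P z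
last-All (x ∷ []) (p ∷ []) refl = p
last-All (x ∷ y ∷ xs) (_ ∷ ps) eq = last-All (y ∷ xs) ps eq

lower-bound-from-last : ∀ {k} cs → Linked _≻_ cs → (∀ z → last cs ≡ just z → k ≤ proj₂ z) →
                        All (λ p → k ≤ proj₂ p) cs
lower-bound-from-last [] _ _ = []
lower-bound-from-last (x ∷ []) _ bound = bound x refl ∷ []
lower-bound-from-last (x ∷ y ∷ cs) (x≻y ∷ desc) bound with lower-bound-from-last (y ∷ cs) desc bound
... | k≤y ∷ rest = ℤP.≤-trans k≤y (ℤP.<⇒≤ (proj₂ x≻y)) ∷ k≤y ∷ rest

c-++-junction : ∀ u (A B : List Column) →
  (∀ a b → last A ≡ just (a , b) → ∀ p q rest → B ≡ (p , q) ∷ rest → cCol u (a , b) ≻ (p , q)) →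
  Connected _≻_ (last (c u A)) (head B)
c-++-junction u A [] _ with last (c u A)
... | just _ = just-nothing
... | nothing = nothing
c-++-junction u A ((p , q) ∷ B) junction rewrite last-map (cCol u) A with last A
... | nothing = nothing-just
... | just (a , b) = connected (junction a b refl p q B refl)

split-++ : ∀ {A : Set} {P Q : A → Set} → (∀ p → P p → Q p → ⊥) →
           ∀ xs xs′ ys ys′ → xs ++ ys ≡ xs′ ++ ys′ → All P xs → All P xs′ →
           (∀ y rest → ys ≡ y ∷ rest → Q y) → (∀ y rest → ys′ ≡ y ∷ rest → Q y) →
           xs ≡ xs′ × ys ≡ ys′
split-++ disjoint [] [] ys ys′ eq _ _ _ _ = refl , eq
split-++ disjoint [] (x′ ∷ xs′) ys ys′ eq _ (p ∷ _) q _ = ⊥-elim (disjoint x′ p (q x′ _ eq))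
split-++ disjoint (x ∷ xs) [] ys ys′ eq (p ∷ _) _ _ q′ = ⊥-elim (disjoint x p (q′ x _ (sym eq)))
split-++ disjoint (x ∷ xs) (x′ ∷ xs′) ys ys′ eq (_ ∷ ps) (_ ∷ ps′) q q′ with ∷-injective eq
... | refl , eq′ with split-++ disjoint xs xs′ ys ys′ eq′ ps ps′ q q′
... | refl , eq″ = refl , eq″

-- Throughout,
-- u = g - f + 1 is the shift of the conjugate map and r = f - 2g + 1 the
-- index of the Dyson map.  Each inequality a ≤ b is proved by writing
-- b - a as a sum of terms that are nonnegative by hypothesis; the ring
-- solver checks the identity.
private
  gap : ∀ {a b} → a ≤ b → + 0 ≤ b - a
  gap = ℤP.i≤j⇒0≤j-i

  gap< : ∀ {a b} → a < b → + 0 ≤ b - (+ 1 + a)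
  gap< a<b = gap (ℤP.i<j⇒suc[i]≤j a<b)

  infixl 6 _⊕_
  _⊕_ : ∀ {a b} → + 0 ≤ a → + 0 ≤ b → + 0 ≤ a + b
  _⊕_ = ℤP.+-mono-≤

  by-gap : ∀ {a b} s → + 0 ≤ s → s ≡ b - a → a ≤ b
  by-gap s 0≤s eq = ℤP.0≤i-j⇒j≤i (subst (+ 0 ≤_) eq 0≤s)

  by-gap< : ∀ {a b} s → + 0 ≤ s → s ≡ b - (+ 1 + a) → a < b
  by-gap< s 0≤s eq = ℤP.suc[i]≤j⇒i<j (by-gap s 0≤s eq)

  nonneg : ∀ n → + 0 ≤ + n
  nonneg n = ℤ.+≤+ z≤n

conjugate-column-bound : ∀ f g a b → f ≤ a - b →
  (b - (g - f + + 1)) - (a + (g - f + + 1)) ≤ f - (g + g) - + 2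
conjugate-column-bound f g a b hi = by-gap _ (gap hi) (identity f g a b)
  where
  identity : ∀ f g a b → (a - b) - f ≡ (f - (g + g) - + 2) - ((b - (g - f + + 1)) - (a + (g - f + + 1)))
  identity = ℤSolver.solve-∀

dyson-column-bound : ∀ f g β p q → p ≡ β + (f - (g + g) + + 1) - + 1 → q ≤ + 1 + β →
  f - (g + g) - + 1 ≤ p - q
dyson-column-bound f g β p q p≡ q≤ = by-gap _ (gap q≤ ⊕ gap (ℤP.≤-reflexive (sym p≡))) (identity f g β p q)
  where
  identity : ∀ f g β p q → ((+ 1 + β) - q) + (p - (β + (f - (g + g) + + 1) - + 1)) ≡ (p - q) - (f - (g + g) - + 1)
  identity = ℤSolver.solve-∀

rank-bounds-disjoint : ∀ f g d → f - (g + g) - + 1 ≤ d → d ≤ f - (g + g) - + 2 → ⊥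
rank-bounds-disjoint f g d lower upper = negative (subst (+ 0 ≤_) (identity f g d) (gap lower ⊕ gap upper))
  where
  identity : ∀ f g d → (d - (f - (g + g) - + 1)) + ((f - (g + g) - + 2) - d) ≡ - + 1
  identity = ℤSolver.solve-∀
  negative : + 0 ≤ - + 1 → ⊥
  negative ()

-- Junction, upper row: the upper entry of the first column of d_r(R) lies
-- below the upper entry b_{t-1} - u of the last column of c_u(L), by (iv).
junction-upper : ∀ f g β b p → p ≡ β + (f - (g + g) + + 1) - + 1 → β - g + + 1 < b →
  p < b - (g - f + + 1)
junction-upper f g β b p p≡ hiv = by-gap< _ (gap< hiv ⊕ gap (ℤP.≤-reflexive p≡)) (identity f g β b p)
  where
  identity : ∀ f g β b p → (b - (+ 1 + (β - g + + 1))) + ((β + (f - (g + g) + + 1) - + 1) - p) ≡ (b - (g - f + + 1)) - (+ 1 + p)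
  identity = ℤSolver.solve-∀

-- Junction, lower row: the lower entry q ≤ β + 1 of the first column of d_r(R)
-- lies below a_{t-1} + u, by (i) and (iv).
junction-lower : ∀ f g a b β q → f ≤ a - b → β - g + + 1 < b → q ≤ + 1 + β → q < a + (g - f + + 1)
junction-lower f g a b β q hi hiv q≤ = by-gap< _ (gap hi ⊕ gap< hiv ⊕ gap q≤ ⊕ nonneg 1) (identity f g a b β q)
  where
  identity : ∀ f g a b β q → ((a - b) - f) + (b - (+ 1 + (β - g + + 1))) + ((+ 1 + β) - q) + + 1 ≡ (a + (g - f + + 1)) - (+ 1 + q)
  identity = ℤSolver.solve-∀

-- The shift u is at most b_{t-1}, by (ii), (iv) and α₁ ≥ 0; hence the upper
-- row of c_u(L) is nonnegative.
shift≤lower : ∀ f g α β b → α - β ≤ f - (g + g) + + 1 → + 0 ≤ α → β - g + + 1 < b → g - f + + 1 ≤ b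
shift≤lower f g α β b hii α≥0 hiv = by-gap _ (gap hii ⊕ gap α≥0 ⊕ gap< hiv) (identity f g α β b)
  where
  identity : ∀ f g α β b → ((f - (g + g) + + 1) - (α - β)) + (α - + 0) + (b - (+ 1 + (β - g + + 1))) ≡ b - (g - f + + 1)
  identity = ℤSolver.solve-∀

conjugate-lower-nonneg : ∀ f g a b → + 1 ≤ g → f ≤ a - b → + 0 ≤ b → + 0 ≤ a + (g - f + + 1)
conjugate-lower-nonneg f g a b g≥1 hi b≥0 = by-gap _ (gap g≥1 ⊕ gap hi ⊕ gap b≥0 ⊕ nonneg 2) (identity f g a b)
  where
  identity : ∀ f g a b → (g - + 1) + ((a - b) - f) + (b - + 0) + + 2 ≡ (a + (g - f + + 1)) - + 0
  identity = ℤSolver.solve-∀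

mu-rank-bound : ∀ f g h a b → h ≤ a - b → (b - (g - f + + 1)) - (a + (g - f + + 1)) ≤ - h + (f + f) - (g + g) - + 2
mu-rank-bound f g h a b h≤ = by-gap _ (gap h≤) (identity f g h a b)
  where
  identity : ∀ f g h a b → (a - b) - h ≡ (- h + (f + f) - (g + g) - + 2) - ((b - (g - f + + 1)) - (a + (g - f + + 1)))
  identity = ℤSolver.solve-∀

-- |L| + |R| - (|L| + |d_r(R)|) = 2g - f, since |d_r(R)| = |R| + r - 1.
size-balance : ∀ f g sL sR → sL + sR - (sL + (sR + (f - (g + g) + + 1) - + 1)) ≡ (g + g) - f
size-balance = ℤSolver.solve-∀

module Construction (f g : ℤ) (g≥1 : + 1 ≤ g) (L : List ℕ) (x : ℕ) (xs : List ℕ) (hyp : Hyp f g L (x ∷ xs)) where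
  open Hyp hyp

  u r : ℤ
  u = g - f + + 1
  r = f - (g + g) + + 1

  α β : ℤ
  α = + (x ℕ.∸ 1)
  β = + length xs

  R-hook : frob (x ∷ xs) ≡ (α , β) ∷ frob (dropColumn xs)
  R-hook = hook x xs R-partition

  -- rank(R) = α₁ - β₁ ≤ r by (ii), so d_r(R) is defined.
  R-rank : rank (x ∷ xs) ≤ r
  R-rank = subst (_≤ r) (trans (sym (cong rankF R-hook)) (rank-frob (x ∷ xs) R-partition)) (hyp-ii α β _ R-hook)

  -- (iv) for the last column of L.
  hyp-iv : ∀ a b → last (frob L) ≡ just (a , b) → β - g + + 1 ℤ.< b
  hyp-iv a b eq = proj₂ (hyp-iii-iv α β _ R-hook a b eq)

  open Dyson r x xs R-partition R-rank public using (dyson-partition; dyson-size; dyson-head)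

  A D : List Column
  A = c u (frob L)
  D = frob (dyson r (x ∷ xs))

  L-frobenius : IsFrobenius (frob L)
  L-frobenius = frob-isFrobenius L L-partition

  left-bound : All (λ p → proj₁ p - proj₂ p ≤ f - (g + g) - + 2) A
  left-bound = AllP.map⁺ (All.map (λ {p} hi → conjugate-column-bound f g (proj₁ p) (proj₂ p) hi) hyp-i)

  right-bound : ∀ p q rest → D ≡ (p , q) ∷ rest → f - (g + g) - + 1 ≤ p - q
  right-bound p q rest eq with dyson-head p q rest eq
  ... | p≡ , q≤ = dyson-column-bound f g β p q p≡ q≤

  junction : Connected _≻_ (last A) (head D)
  junction = c-++-junction u (frob L) D dominates
    where
    dominates : ∀ a b → last (frob L) ≡ just (a , b) → ∀ p q rest → D ≡ (p , q) ∷ rest → cCol u (a , b) ≻ (p , q)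
    dominates a b eqL p q rest eqD with dyson-head p q rest eqD
    ... | p≡ , q≤ = junction-upper f g β b p p≡ (hyp-iv a b eqL) ,
                    junction-lower f g a b β q (last-All (frob L) hyp-i eqL) (hyp-iv a b eqL) q≤

  -- The entries of c_u(L) are nonnegative: b_y - u ≥ b_{t-1} - u ≥ 0 and a_y + u ≥ 0.
  A-nonneg : All (λ p → + 0 ≤ proj₁ p × + 0 ≤ proj₂ p) A
  A-nonneg = AllP.map⁺ (All.zipWith column (hyp-i , All.zip (proj₂ L-frobenius , u≤lower)))
    where
    u≤lower : All (λ p → u ≤ proj₂ p) (frob L)
    u≤lower = lower-bound-from-last (frob L) (proj₁ L-frobenius)
      (λ (a , b) eq → shift≤lower f g α β b (hyp-ii α β _ R-hook) (ℤ.+≤+ z≤n) (hyp-iv a b eq))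
    column : ∀ {p} → (f ≤ proj₁ p - proj₂ p) × ((+ 0 ≤ proj₁ p × + 0 ≤ proj₂ p) × u ≤ proj₂ p) →
             + 0 ≤ proj₂ p - u × + 0 ≤ proj₁ p + u
    column {a , b} (hi , ((_ , b≥0) , u≤b)) =
      ℤP.i≤j⇒0≤j-i u≤b , conjugate-lower-nonneg f g a b g≥1 hi b≥0

  mu-frobenius : IsFrobenius (A ++ D)
  mu-frobenius =
    LinkedP.++⁺ (c-descending u (frob L) (proj₁ L-frobenius)) junction (proj₁ (frob-isFrobenius _ dyson-partition)) ,
    AllP.++⁺ A-nonneg (proj₂ (frob-isFrobenius _ dyson-partition))

  mu-size : + size L + + size (x ∷ xs) - sizeF (A ++ D) ≡ (g + g) - f
  mu-size = begin
    + size L + + size (x ∷ xs) - sizeF (A ++ D)                ≡⟨ cong (λ s → + size L + + size (x ∷ xs) - s) sizes ⟩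
    + size L + + size (x ∷ xs) - (+ size L + (+ size (x ∷ xs) + r - + 1)) ≡⟨ size-balance f g (+ size L) (+ size (x ∷ xs)) ⟩
    (g + g) - f                                                 ∎
    where
    open ≡-Reasoning
    sizes : sizeF (A ++ D) ≡ + size L + (+ size (x ∷ xs) + r - + 1)
    sizes = begin
      sizeF (A ++ D)                              ≡⟨ sizeF-++ A D ⟩
      sizeF A + sizeF D                           ≡⟨ cong₂ _+_ (trans (c-size u (frob L)) (frob-size L L-partition))
                                                               (frob-size _ dyson-partition) ⟩
      + size L + + size (dyson r (x ∷ xs))        ≡⟨ cong (λ s → + size L + s) dyson-size ⟩
      + size L + (+ size (x ∷ xs) + r - + 1)      ∎

mu-rank : ∀ f g h L B → IsPartition L → L ≢ [] → h ≤ rank L →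
          rankF (c (g - f + + 1) (frob L) ++ B) ≤ - h + (f + f) - (g + g) - + 2
mu-rank f g h [] B _ L≢[] _ = ⊥-elim (L≢[] refl)
mu-rank f g h (y ∷ ys) B pt _ h≤rank =
  subst (λ cs → rankF (c (g - f + + 1) cs ++ B) ≤ - h + (f + f) - (g + g) - + 2) (sym L-hook)
    (mu-rank-bound f g h (+ (y ℕ.∸ 1)) (+ length ys) (subst (h ≤_) (trans (sym (rank-frob (y ∷ ys) pt)) (cong rankF L-hook)) h≤rank))
  where
  L-hook : frob (y ∷ ys) ≡ (+ (y ℕ.∸ 1) , + length ys) ∷ frob (dropColumn ys)
  L-hook = hook y ys pt

-- (4) The pair (L , R) is recovered from μ: by (2) the split point between
-- c_u(L) and d_r(R) is determined, and c_u, frob and d_r are injective.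
mu-injective : ∀ f g → (g≥1 : + 1 ≤ g) → ∀ L x xs L′ x′ xs′ →
               (hyp : Hyp f g L (x ∷ xs)) (hyp′ : Hyp f g L′ (x′ ∷ xs′)) →
               mu f g L′ (x′ ∷ xs′) ≡ mu f g L (x ∷ xs) → L′ ≡ L × x′ ∷ xs′ ≡ x ∷ xs
mu-injective f g g≥1 L x xs L′ x′ xs′ hyp hyp′ eq =
  frob-injective L′ (Hyp.L-partition hyp′) L (Hyp.L-partition hyp) (c-injective (g - f + + 1) (proj₁ split)) ,
  dyson-injective (f - (g + g) + + 1) x′ xs′ x xs (Hyp.R-partition hyp′) (Hyp.R-partition hyp) M′.R-rank M.R-rank
    (frob-injective _ M′.dyson-partition _ M.dyson-partition (proj₂ split))
  where
  module M = Construction f g g≥1 L x xs hyp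
  module M′ = Construction f g g≥1 L′ x′ xs′ hyp′
  split : M′.A ≡ M.A × M′.D ≡ M.D
  split = split-++ (λ (p , q) upper lower → rank-bounds-disjoint f g (p - q) lower upper)
            M′.A M.A M′.D M.D eq M′.left-bound M.left-bound
            (λ (p , q) rest e → M′.right-bound p q rest e) (λ (p , q) rest e → M.right-bound p q rest e)

lemma3p3 : (f g h : ℤ) → + 1 ≤ g → f + + 1 ≤ g + g → f ≤ h →
    (L R : List ℕ) → Hyp f g L R →
    -- (1) μ is a Frobenius symbol
    IsFrobenius (mu f g L R)
    -- (2) first t-1 columns: μ₁y - μ₂y ≤ f - 2g - 2; column t (if any): ≥ f - 2g - 1
    × All (λ p → proj₁ p - proj₂ p ≤ f - (g + g) - + 2) (take (length (frob L)) (mu f g L R))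
    × (∀ x y rest → drop (length (frob L)) (mu f g L R) ≡ (x , y) ∷ rest →
         f - (g + g) - + 1 ≤ x - y)
    -- (3) rank bound
    × (L ≢ [] → h ≤ rank L → rankF (mu f g L R) ≤ - h + (f + f) - (g + g) - + 2)
    -- (4) reversibility: (L , R) ↦ μ is injective on pairs satisfying the hypotheses
    × (∀ L′ R′ → Hyp f g L′ R′ → mu f g L′ R′ ≡ mu f g L R → L′ ≡ L × R′ ≡ R)
    -- (5) |L| + |R| - |μ| = 2g - f
    × (+ size L + + size R - sizeF (mu f g L R) ≡ (g + g) - f)
lemma3p3 f g h g≥1 _ _ L [] hyp = ⊥-elim (Hyp.R-nonempty hyp refl)
lemma3p3 f g h g≥1 _ _ L (x ∷ xs) hyp =
  mu-frobenius ,
  subst (All _) (sym (take-map-++ (cCol u) (frob L) D)) left-bound ,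
  (λ p q rest eq → right-bound p q rest (trans (sym (drop-map-++ (cCol u) (frob L) D)) eq)) ,
  mu-rank f g h L D (Hyp.L-partition hyp) ,
  reversible ,
  mu-size
  where
  open Construction f g g≥1 L x xs hyp
  reversible : ∀ L′ R′ → Hyp f g L′ R′ → mu f g L′ R′ ≡ mu f g L (x ∷ xs) → L′ ≡ L × R′ ≡ x ∷ xs
  reversible L′ [] hyp′ _ = ⊥-elim (Hyp.R-nonempty hyp′ refl)
  reversible L′ (x′ ∷ xs′) hyp′ = mu-injective f g g≥1 L x xs L′ x′ xs′ hyp hyp′
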